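{- For every integer $m\ge 1$, the digraph ${\cal D}_m$ has exactly $3^m+(-1)^m$ vertices.
   Context: The alpha-letters are the 2-element subsets of $\{\text{up},\text{down},\text{left},\text{right}\}$: $a=\{\text{right},\text{down}\}$, $b=\{\text{up},\text{down}\}$, $c=\{\text{right},\text{up}\}$, $d=\{\text{left},\text{down}\}$, $e=\{\text{left},\text{right}\}$, $f=\{\text{left},\text{up}\}$. ${\cal D}_{ud}$ is the digraph (loops allowed) on $\{a,\dots,f\}$ with an arc $(\alpha,\beta)$ iff ($\text{down}\in\alpha\iff\text{up}\in\beta$); ${\cal D}_{lr}$ has an arc $(\alpha,\beta)$ iff ($\text{right}\in\alpha\iff\text{left}\in\beta$). ${\cal D}_m$ is the digraph whose vertices are all words $\alpha_1\cdots\alpha_m\in\{a,\dots,f\}^m$ with $(\alpha_i,\alpha_{i+1})$ an arc of ${\cal D}_{ud}$ for all $1\le i\le m$ ($\alpha_{m+1}:=\alpha_1$), and with an arc $v\to u$ iff $(v_i,u_i)$ is an arc of ${\cal D}_{lr}$ for every $i$. -}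

module Defs where

open import Data.Bool using (Bool; true; false; T; _∧_)
open import Data.Nat using (ℕ; zero; suc)
open import Data.Fin using (Fin)
open import Data.Vec using (Vec; []; _∷_; lookup)
open import Data.Product using (Σ; _,_)
open import Relation.Nullary using (Dec)

data Dir : Set where
  up down left right : Dir

-- Alpha-letters: the six 2-element subsets of {up,down,left,right}.
data Letter : Set where
  a b c d e f : Letter

_∈L_ : Dir → Letter → Bool
right ∈L a = true
down  ∈L a = true
up    ∈L b = true
down  ∈L b = true
right ∈L c = true
up    ∈L c = true
left  ∈L d = true
down  ∈L d = true
left  ∈L e = true
right ∈L e = true
left  ∈L f = true
up    ∈L f = true
_     ∈L _ = false

_⇔ᵇ_ : Bool → Bool → Bool
true  ⇔ᵇ true  = true
false ⇔ᵇ false = true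
_     ⇔ᵇ _     = false

arcUDᵇ : Letter → Letter → Bool
arcUDᵇ α β = (down ∈L α) ⇔ᵇ (up ∈L β)

arcLRᵇ : Letter → Letter → Bool
arcLRᵇ α β = (right ∈L α) ⇔ᵇ (left ∈L β)

-- Cyclic D_ud-condition on a word α₁⋯α_m (with α_{m+1} := α₁), m ≥ 1.
-- chain x w : consecutive pairs of w are D_ud-arcs and (last w, x) is a D_ud-arc.
chainᵇ : ∀ {n} → Letter → Letter → Vec Letter n → Bool
chainᵇ first prev []      = arcUDᵇ prev first
chainᵇ first prev (y ∷ w) = arcUDᵇ prev y ∧ chainᵇ first y w

cyclicUDᵇ : ∀ {m} → Vec Letter m → Bool
cyclicUDᵇ []      = true   -- not used: m ≥ 1 in the statement
cyclicUDᵇ (x ∷ w) = chainᵇ x x w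

-- Vertices of D_m: words of length m satisfying the cyclic D_ud condition.
-- (The condition is a T of a Bool, hence proof-irrelevant, so this type
-- has exactly as many elements as the vertex set.)
Vertex : ℕ → Set
Vertex m = Σ (Vec Letter m) (λ w → T (cyclicUDᵇ w))

Arc : ∀ {m} → Vertex m → Vertex m → Set
Arc {m} (v , _) (u , _) = (i : Fin m) → T (arcLRᵇ (lookup v i) (lookup u i))

-- Whether (α, β) is an arc of D_ud depends only on the down-bit of α and the
-- up-bit of β.  Counting closed walks by these bits gives the transfer matrix
-- [[1,2],[2,1]] (letters with given up- and down-bits: b; c,f; a,d; e), whose
-- eigenvalues are 3 and -1; so twice the number of chains of length n between
-- bits p and q is 3ⁿ ± (-1)ⁿ, and summing over the six letters gives the trace.
module Submission where

open import Defs
open import Data.Bool using (Bool; true; false; T; _∧_; not; if_then_else_)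
open import Data.Nat as ℕ using (ℕ; zero; suc; _≥_)
open import Data.Integer using (ℤ; +_; -_; _+_; _*_; _^_; 1ℤ; -1ℤ)
open import Data.Integer.Properties using (pos-+; *-cancelˡ-≡)
import Data.Integer.Tactic.RingSolver as ℤ-Solver
import Data.Nat.Tactic.RingSolver as ℕ-Solver
open import Data.Fin using (Fin)
open import Data.Fin.Properties using (+↔⊎; 1↔⊤)
open import Data.Product using (Σ; _×_; _,_)
open import Data.Sum using (_⊎_; inj₁; inj₂)
open import Data.Vec using (Vec; []; _∷_)
open import Function.Bundles using (_↔_; mk↔ₛ′)
open import Function.Properties.Inverse using (↔-trans; ↔-sym)
open import Data.Sum.Function.Propositional using (_⊎-↔_)
open import Relation.Binary.PropositionalEquality
  using (_≡_; refl; trans; cong; cong₂; module ≡-Reasoning)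

private
  variable
    A : Set
    n k : ℕ

⊎-↔-Fin : ∀ {B C : Set} {l m} → B ↔ Fin l → C ↔ Fin m → (B ⊎ C) ↔ Fin (l ℕ.+ m)
⊎-↔-Fin i j = ↔-trans (i ⊎-↔ j) (↔-sym +↔⊎)

T↔Fin : (β : Bool) → T β ↔ Fin (if β then 1 else 0)
T↔Fin true  = ↔-sym 1↔⊤
T↔Fin false = mk↔ₛ′ (λ ()) (λ ()) (λ ()) (λ ())

Σ-Vec-zero-↔ : {P : Vec A 0 → Set} → Σ (Vec A 0) P ↔ P []
Σ-Vec-zero-↔ = mk↔ₛ′ (λ { ([] , p) → p }) ([] ,_) (λ _ → refl) (λ { ([] , p) → refl })

Σ-Vec-suc-↔ : {P : Vec A (suc n) → Set} →
              Σ (Vec A (suc n)) P ↔ Σ A (λ x → Σ (Vec A n) (λ w → P (x ∷ w)))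
Σ-Vec-suc-↔ = mk↔ₛ′ (λ { (x ∷ w , p) → x , w , p }) (λ { (x , w , p) → x ∷ w , p })
                    (λ _ → refl) (λ { (x ∷ w , p) → refl })

Σ-T-∧-↔ : {V : Set} {Q : V → Bool} (β : Bool) →
          Σ V (λ v → T (Q v)) ↔ Fin k →
          Σ V (λ v → T (β ∧ Q v)) ↔ Fin (if β then k else 0)
Σ-T-∧-↔ true  i = i
Σ-T-∧-↔ false _ = mk↔ₛ′ (λ { (_ , ()) }) (λ ()) (λ ()) (λ { (_ , ()) })

sumLetters : (Letter → ℕ) → ℕ
sumLetters g = g a ℕ.+ (g b ℕ.+ (g c ℕ.+ (g d ℕ.+ (g e ℕ.+ g f))))

Σ-Letter-↔ : {P : Letter → Set} {g : Letter → ℕ} →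
             (∀ x → P x ↔ Fin (g x)) → Σ Letter P ↔ Fin (sumLetters g)
Σ-Letter-↔ {P} i = ↔-trans Σ↔⊎ (⊎-↔-Fin (i a) (⊎-↔-Fin (i b) (⊎-↔-Fin (i c)
                     (⊎-↔-Fin (i d) (⊎-↔-Fin (i e) (i f))))))
  where
  Σ↔⊎ : Σ Letter P ↔ (P a ⊎ (P b ⊎ (P c ⊎ (P d ⊎ (P e ⊎ P f)))))
  Σ↔⊎ = mk↔ₛ′ to from to∘from from∘to
    where
    to : Σ Letter P → P a ⊎ (P b ⊎ (P c ⊎ (P d ⊎ (P e ⊎ P f))))
    to (a , p) = inj₁ p
    to (b , p) = inj₂ (inj₁ p)
    to (c , p) = inj₂ (inj₂ (inj₁ p))
    to (d , p) = inj₂ (inj₂ (inj₂ (inj₁ p)))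
    to (e , p) = inj₂ (inj₂ (inj₂ (inj₂ (inj₁ p))))
    to (f , p) = inj₂ (inj₂ (inj₂ (inj₂ (inj₂ p))))
    from : P a ⊎ (P b ⊎ (P c ⊎ (P d ⊎ (P e ⊎ P f)))) → Σ Letter P
    from (inj₁ p)                                = a , p
    from (inj₂ (inj₁ p))                         = b , p
    from (inj₂ (inj₂ (inj₁ p)))                  = c , p
    from (inj₂ (inj₂ (inj₂ (inj₁ p))))           = d , p
    from (inj₂ (inj₂ (inj₂ (inj₂ (inj₁ p)))))    = e , p
    from (inj₂ (inj₂ (inj₂ (inj₂ (inj₂ p)))))    = f , p
    to∘from : ∀ z → to (from z) ≡ z
    to∘from (inj₁ p)                             = refl
    to∘from (inj₂ (inj₁ p))                      = refl
    to∘from (inj₂ (inj₂ (inj₁ p)))               = refl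
    to∘from (inj₂ (inj₂ (inj₂ (inj₁ p))))        = refl
    to∘from (inj₂ (inj₂ (inj₂ (inj₂ (inj₁ p))))) = refl
    to∘from (inj₂ (inj₂ (inj₂ (inj₂ (inj₂ p))))) = refl
    from∘to : ∀ z → from (to z) ≡ z
    from∘to (a , p) = refl
    from∘to (b , p) = refl
    from∘to (c , p) = refl
    from∘to (d , p) = refl
    from∘to (e , p) = refl
    from∘to (f , p) = refl

Chain : ℕ → Letter → Letter → Set
Chain n prev first = Σ (Vec Letter n) (λ w → T (chainᵇ first prev w))

-- chains n p q counts the chains of length n from a letter with down-bit p
-- back to a letter with up-bit q.
chains : ℕ → Bool → Bool → ℕ
chains zero    p q = if p ⇔ᵇ q then 1 else 0
chains (suc n) p q = sumLetters (λ y → if p ⇔ᵇ (up ∈L y) then chains n (down ∈L y) q else 0)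

closedChains : ℕ → Letter → ℕ
closedChains n x = chains n (down ∈L x) (up ∈L x)

vertexCount : ℕ → ℕ
vertexCount n = sumLetters (closedChains n)

Chain↔Fin : ∀ n prev first → Chain n prev first ↔ Fin (chains n (down ∈L prev) (up ∈L first))
Chain↔Fin zero    prev first = ↔-trans Σ-Vec-zero-↔ (T↔Fin (arcUDᵇ prev first))
Chain↔Fin (suc n) prev first =
  ↔-trans Σ-Vec-suc-↔ (Σ-Letter-↔ λ y → Σ-T-∧-↔ (arcUDᵇ prev y) (Chain↔Fin n y first))

Vertex↔Fin : ∀ n → Vertex (suc n) ↔ Fin (vertexCount n)
Vertex↔Fin n = ↔-trans Σ-Vec-suc-↔ (Σ-Letter-↔ λ x → Chain↔Fin n x x)

chains-suc : ∀ n p q → chains (suc n) p q ≡ chains n p q ℕ.+ (chains n (not p) q ℕ.+ chains n (not p) q)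
chains-suc n true  q = drop-zeros (chains n true q) (chains n false q)
  where
  drop-zeros : ∀ x y → 0 ℕ.+ (x ℕ.+ (y ℕ.+ (0 ℕ.+ (0 ℕ.+ y)))) ≡ x ℕ.+ (y ℕ.+ y)
  drop-zeros = ℕ-Solver.solve-∀
chains-suc n false q = drop-zeros (chains n true q) (chains n false q)
  where
  drop-zeros : ∀ x y → x ℕ.+ (0 ℕ.+ (0 ℕ.+ (x ℕ.+ (y ℕ.+ 0)))) ≡ y ℕ.+ (x ℕ.+ x)
  drop-zeros = ℕ-Solver.solve-∀

sign : Bool → Bool → ℤ
sign p q = if p ⇔ᵇ q then 1ℤ else -1ℤ

sign-not : ∀ p q → sign (not p) q ≡ - sign p q
sign-not true  true  = refl
sign-not true  false = refl
sign-not false true  = refl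
sign-not false false = refl

twice-chains : ∀ n p q → + chains n p q + + chains n p q ≡ (+ 3) ^ n + sign p q * -1ℤ ^ n
twice-chains zero true  true  = refl
twice-chains zero true  false = refl
twice-chains zero false true  = refl
twice-chains zero false false = refl
twice-chains (suc n) p q = begin
  + chains (suc n) p q + + chains (suc n) p q
    ≡⟨ cong (λ z → z + z) (trans (cong +_ (chains-suc n p q)) pos-+-+) ⟩
  (+ x + (+ y + + y)) + (+ x + (+ y + + y))
    ≡⟨ regroup (+ x) (+ y) ⟩
  (+ x + + x) + ((+ y + + y) + (+ y + + y))
    ≡⟨ cong₂ _+_ (twice-chains n p q) (cong (λ z → z + z) (twice-chains n (not p) q)) ⟩
  (S + sign p q * U) + ((S + sign (not p) q * U) + (S + sign (not p) q * U))
    ≡⟨ cong (λ s → (S + sign p q * U) + ((S + s * U) + (S + s * U))) (sign-not p q) ⟩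
  (S + sign p q * U) + ((S + - sign p q * U) + (S + - sign p q * U))
    ≡⟨ closed-form-step S U (sign p q) ⟩
  + 3 * S + sign p q * (-1ℤ * U) ∎
  where
  open ≡-Reasoning
  x = chains n p q
  y = chains n (not p) q
  S = (+ 3) ^ n
  U = -1ℤ ^ n
  pos-+-+ : + (x ℕ.+ (y ℕ.+ y)) ≡ + x + (+ y + + y)
  pos-+-+ = begin
    + (x ℕ.+ (y ℕ.+ y)) ≡⟨ pos-+ x (y ℕ.+ y) ⟩
    + x + + (y ℕ.+ y)   ≡⟨ cong (_+_ (+ x)) (pos-+ y y) ⟩
    + x + (+ y + + y)   ∎
  regroup : ∀ X Y → (X + (Y + Y)) + (X + (Y + Y)) ≡ (X + X) + ((Y + Y) + (Y + Y))
  regroup = ℤ-Solver.solve-∀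
  closed-form-step : ∀ S U s → (S + s * U) + ((S + - s * U) + (S + - s * U)) ≡ + 3 * S + s * (-1ℤ * U)
  closed-form-step = ℤ-Solver.solve-∀

pos-sumLetters : ∀ g → + sumLetters g ≡ + g a + (+ g b + (+ g c + (+ g d + (+ g e + + g f))))
pos-sumLetters g =
  trans (pos-+ (g a) _) (cong (_+_ (+ g a)) (
  trans (pos-+ (g b) _) (cong (_+_ (+ g b)) (
  trans (pos-+ (g c) _) (cong (_+_ (+ g c)) (
  trans (pos-+ (g d) _) (cong (_+_ (+ g d)) (
  pos-+ (g e) (g f)))))))))

twice-sumLetters : ∀ g (h : Letter → ℤ) → (∀ x → + g x + + g x ≡ h x) →
                   + sumLetters g + + sumLetters g ≡ h a + (h b + (h c + (h d + (h e + h f))))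
twice-sumLetters g h twice = begin
  + sumLetters g + + sumLetters g
    ≡⟨ cong (λ z → z + z) (pos-sumLetters g) ⟩
  (+ g a + (+ g b + (+ g c + (+ g d + (+ g e + + g f))))) +
  (+ g a + (+ g b + (+ g c + (+ g d + (+ g e + + g f)))))
    ≡⟨ regroup (+ g a) (+ g b) (+ g c) (+ g d) (+ g e) (+ g f) ⟩
  (+ g a + + g a) + ((+ g b + + g b) + ((+ g c + + g c) +
    ((+ g d + + g d) + ((+ g e + + g e) + (+ g f + + g f)))))
    ≡⟨ cong₂ _+_ (twice a) (cong₂ _+_ (twice b) (cong₂ _+_ (twice c)
         (cong₂ _+_ (twice d) (cong₂ _+_ (twice e) (twice f))))) ⟩
  h a + (h b + (h c + (h d + (h e + h f)))) ∎
  where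
  open ≡-Reasoning
  regroup : ∀ A B C D E F → (A + (B + (C + (D + (E + F))))) + (A + (B + (C + (D + (E + F))))) ≡
            (A + A) + ((B + B) + ((C + C) + ((D + D) + ((E + E) + (F + F)))))
  regroup = ℤ-Solver.solve-∀

double-injective : ∀ i j → i + i ≡ j + j → i ≡ j
double-injective i j i+i≡j+j = *-cancelˡ-≡ (+ 2) i j (begin
  + 2 * i ≡⟨ double i ⟩
  i + i   ≡⟨ i+i≡j+j ⟩
  j + j   ≡⟨ double j ⟨
  + 2 * j ∎)
  where
  open ≡-Reasoning
  double : ∀ k → + 2 * k ≡ k + k
  double = ℤ-Solver.solve-∀

vertexCount-closed : ∀ n → + vertexCount n ≡ (+ 3) ^ suc n + -1ℤ ^ suc n
vertexCount-closed n = double-injective _ _ (begin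
  + vertexCount n + + vertexCount n
    ≡⟨ twice-sumLetters (closedChains n) _ (λ x → twice-chains n (down ∈L x) (up ∈L x)) ⟩
  (S + -1ℤ * U) + ((S + 1ℤ * U) + ((S + -1ℤ * U) + ((S + -1ℤ * U) +
    ((S + 1ℤ * U) + (S + -1ℤ * U)))))
    ≡⟨ trace S U ⟩
  (+ 3 * S + -1ℤ * U) + (+ 3 * S + -1ℤ * U) ∎)
  where
  open ≡-Reasoning
  S = (+ 3) ^ n
  U = -1ℤ ^ n
  trace : ∀ S U → (S + -1ℤ * U) + ((S + 1ℤ * U) + ((S + -1ℤ * U) + ((S + -1ℤ * U) +
            ((S + 1ℤ * U) + (S + -1ℤ * U))))) ≡ (+ 3 * S + -1ℤ * U) + (+ 3 * S + -1ℤ * U)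
  trace = ℤ-Solver.solve-∀

lemma4 : (m : ℕ) → m ≥ 1 →
    Σ ℕ (λ N → (+ N ≡ (+ 3) ^ m + (- (+ 1)) ^ m) × (Vertex m ↔ Fin N))
lemma4 (suc n) _ = vertexCount n , vertexCount-closed n , Vertex↔Fin n
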